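{- Let $\Gamma$ be a countable discrete abelian group and $k \in \mathbb{N}$. Suppose $C \subseteq \Gamma$ contains $B^{\oplus k}$ for some infinite $B \subseteq \Gamma$, and let $\Lambda \le \Gamma$ be a finite index subgroup with $k\Gamma \subseteq \Lambda$. Then there is an infinite set $B' \subseteq \Gamma$ with $B'^{\oplus k} \subseteq C \cap \Lambda$.
   Context: $k\Gamma = \{kx : x \in \Gamma\}$. For $B \subseteq \Gamma$, $B^{\oplus k} = \{\sum_{x \in F} x : F \subseteq B,\ |F| = k\}$. -}

module Defs where

open import Level using (Level; _⊔_; suc)
open import Algebra.Bundles using (AbelianGroup)
open import Data.Nat using (ℕ; zero; suc)
open import Data.Fin using (Fin)
open import Data.List using (List; []; _∷_; length; foldr)
open import Data.List.Relation.Unary.All using (All)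
open import Data.List.Relation.Unary.Any using (Any)
open import Data.List.Relation.Unary.AllPairs using (AllPairs)
open import Data.Product using (Σ; ∃; _×_)
open import Relation.Nullary using (¬_)
open import Relation.Unary using (Pred)
open import Relation.Binary.PropositionalEquality using (_≡_)

module _ {c ℓ : Level} (G : AbelianGroup c ℓ) where
  open AbelianGroup G

  Countable : Set (c ⊔ ℓ)
  Countable = Σ (Carrier → ℕ) λ f → ∀ x y → f x ≡ f y → x ≈ y

  Respects : {p : Level} → Pred Carrier p → Set (c ⊔ ℓ ⊔ p)
  Respects P = ∀ {x y} → x ≈ y → P x → P y

  Finite : {p : Level} → Pred Carrier p → Set (c ⊔ ℓ ⊔ p)
  Finite P = Σ (List Carrier) λ xs → ∀ x → P x → Any (x ≈_) xs

  Infinite : {p : Level} → Pred Carrier p → Set (c ⊔ ℓ ⊔ p)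
  Infinite P = ¬ Finite P

  _⊆_ : {p q : Level} → Pred Carrier p → Pred Carrier q → Set (c ⊔ p ⊔ q)
  P ⊆ Q = ∀ x → P x → Q x

  sumL : List Carrier → Carrier
  sumL = foldr _∙_ ε

  -- B^{⊕k}: sums of k-element subsets F ⊆ B (F given as a list of
  -- k pairwise distinct elements of B)
  sumset : {p : Level} → Pred Carrier p → ℕ → Pred Carrier (c ⊔ ℓ ⊔ p)
  sumset B k x = Σ (List Carrier) λ xs →
    (length xs ≡ k) × All B xs × AllPairs (λ a b → ¬ a ≈ b) xs × (x ≈ sumL xs)

  mul : ℕ → Carrier → Carrier
  mul zero    g = ε
  mul (suc k) g = g ∙ mul k g

  record IsSubgroup {p : Level} (Λ : Pred Carrier p) : Set (c ⊔ ℓ ⊔ p) where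
    field
      resp  : Respects Λ
      ε∈    : Λ ε
      ∙-closed : ∀ {x y} → Λ x → Λ y → Λ (x ∙ y)
      ⁻¹-closed : ∀ {x} → Λ x → Λ (x ⁻¹)

  FiniteIndex : {p : Level} → Pred Carrier p → Set (c ⊔ p)
  FiniteIndex Λ = Σ ℕ λ n → Σ (Fin n → Carrier) λ r →
    ∀ g → ∃ λ (i : Fin n) → Λ (g ∙ (r i) ⁻¹)

{-# OPTIONS --safe #-}
module Submission where

-- The finitely many cosets g + Λ partition Γ, so some coset meets B in an
-- infinite set B′ (only up to double negation, since finiteness is not
-- decidable). A sum of k elements of g + Λ lies in kg + Λ = Λ, and it is a
-- sum of k elements of B, so it lies in C as well.

open import Defs
open import Level using (Level)
open import Algebra.Bundles using (AbelianGroup)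
import Algebra.Properties.AbelianGroup as AbelianGroupProperties
open import Data.Nat using (ℕ; zero; suc)
open import Data.Fin using (Fin; zero; suc)
open import Data.Fin.Properties using (∀-cons)
open import Data.List using ([]; _∷_; length; concat; tabulate)
open import Data.List.Relation.Unary.All as All using (All; []; _∷_)
open import Data.List.Relation.Unary.Any.Properties using (concat⁺; tabulate⁺)
open import Data.Product using (Σ; ∃; _×_; _,_; proj₁; proj₂)
open import Function using (_∘_)
open import Relation.Nullary using (¬_)
open import Relation.Nullary.Negation using (¬¬-map)
open import Relation.Unary using (Pred; _∩_)
open import Relation.Binary.PropositionalEquality using (refl)

¬¬-∀-Fin : ∀ {a} n {P : Fin n → Set a} → (∀ i → ¬ ¬ P i) → ¬ ¬ (∀ i → P i)
¬¬-∀-Fin zero    _   k = k λ ()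
¬¬-∀-Fin (suc n) ¬¬P k =
  ¬¬P zero λ p₀ → ¬¬-∀-Fin n (¬¬P ∘ suc) λ p₊ → k (∀-cons p₀ p₊)

module _ {c ℓ : Level} (G : AbelianGroup c ℓ) where
  open AbelianGroup G
  open AbelianGroupProperties G using (⁻¹-∙-comm; //-rightDividesˡ)
  open import Algebra.Properties.CommutativeSemigroup commutativeSemigroup
    using (interchange)
  open import Relation.Binary.Reasoning.Setoid setoid

  Finite-cover : ∀ {p q} {B : Pred Carrier p} n (P : Fin n → Pred Carrier q) →
    (∀ x → B x → ∃ λ i → P i x) → (∀ i → Finite G (P i)) → Finite G B
  Finite-cover n P cover finite =
    concat (tabulate (proj₁ ∘ finite)) , λ x x∈B →
      let (i , x∈Pᵢ) = cover x x∈B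
      in concat⁺ (tabulate⁺ i (proj₂ (finite i) x x∈Pᵢ))

  Infinite-piece : ∀ {p q} {B : Pred Carrier p} n (P : Fin n → Pred Carrier q) →
    (∀ x → B x → ∃ λ i → P i x) → Infinite G B →
    ¬ ¬ ∃ λ i → Infinite G (B ∩ P i)
  Infinite-piece {B = B} n P cover infinite noPieceInfinite =
    ¬¬-∀-Fin n (λ i infiniteᵢ → noPieceInfinite (i , infiniteᵢ))
      (infinite ∘ Finite-cover n (λ i → B ∩ P i) cover′)
    where
    cover′ : ∀ x → B x → ∃ λ i → (B ∩ P i) x
    cover′ x x∈B = let (i , x∈Pᵢ) = cover x x∈B in i , x∈B , x∈Pᵢ

  sumset-mono : ∀ {p q} {P : Pred Carrier p} {Q : Pred Carrier q} k →
    _⊆_ G P Q → _⊆_ G (sumset G P k) (sumset G Q k)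
  sumset-mono k P⊆Q x (xs , len , xs⊆P , distinct , x≈Σxs) =
    xs , len , All.map (P⊆Q _) xs⊆P , distinct , x≈Σxs

  module Cosets {p : Level} {Λ : Pred Carrier p} (Λ-subgroup : IsSubgroup G Λ) where
    open IsSubgroup Λ-subgroup

    Coset : Carrier → Pred Carrier p
    Coset g x = Λ (x ∙ g ⁻¹)

    Coset⊆Λ : ∀ {g} → Λ g → _⊆_ G (Coset g) Λ
    Coset⊆Λ {g} g∈Λ x x-g∈Λ = resp (//-rightDividesˡ g x) (∙-closed x-g∈Λ g∈Λ)

    sumL-Coset : ∀ {g} xs → All (Coset g) xs → Coset (mul G (length xs) g) (sumL G xs)
    sumL-Coset {g} []       []             = resp (sym (inverseʳ ε)) ε∈
    sumL-Coset {g} (a ∷ xs) (a∈g+Λ ∷ xs⊆g+Λ) =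
      resp regroup (∙-closed a∈g+Λ (sumL-Coset xs xs⊆g+Λ))
      where
      s = sumL G xs
      m = mul G (length xs) g
      regroup : (a ∙ g ⁻¹) ∙ (s ∙ m ⁻¹) ≈ (a ∙ s) ∙ (g ∙ m) ⁻¹
      regroup = begin
        (a ∙ g ⁻¹) ∙ (s ∙ m ⁻¹) ≈⟨ interchange a (g ⁻¹) s (m ⁻¹) ⟩
        (a ∙ s) ∙ (g ⁻¹ ∙ m ⁻¹) ≈⟨ ∙-congˡ (⁻¹-∙-comm g m) ⟩
        (a ∙ s) ∙ (g ∙ m) ⁻¹    ∎

    sumset-Coset : ∀ {g} k → _⊆_ G (sumset G (Coset g) k) (Coset (mul G k g))
    sumset-Coset k x (xs , refl , xs⊆g+Λ , _ , x≈Σxs) =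
      resp (∙-congʳ (sym x≈Σxs)) (sumL-Coset xs xs⊆g+Λ)

lemma4p1 : {c ℓ p : Level} (G : AbelianGroup c ℓ) → Countable G →
    (k : ℕ) (C B Λ : Pred (AbelianGroup.Carrier G) p) →
    Infinite G B → _⊆_ G (sumset G B k) C →
    IsSubgroup G Λ → FiniteIndex G Λ → (∀ g → Λ (mul G k g)) →
    ¬ ¬ Σ (Pred (AbelianGroup.Carrier G) p)
    (λ B′ → Infinite G B′ × _⊆_ G (sumset G B′ k) (C ∩ Λ))
lemma4p1 G _ k C B Λ B-infinite B⊕k⊆C Λ-subgroup (n , r , cover) kΓ⊆Λ =
  ¬¬-map inCoset (Infinite-piece G n (Coset ∘ r) (λ x _ → cover x) B-infinite)
  where
  open Cosets G Λ-subgroup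
  inCoset : ∃ (λ i → Infinite G (B ∩ Coset (r i))) →
    Σ (Pred _ _) λ B′ → Infinite G B′ × _⊆_ G (sumset G B′ k) (C ∩ Λ)
  inCoset (i , infinite) = B ∩ Coset (r i) , infinite , λ x x∈B′⊕k →
    B⊕k⊆C x (sumset-mono G k (λ _ → proj₁) x x∈B′⊕k) ,
    Coset⊆Λ (kΓ⊆Λ (r i)) x (sumset-Coset k x (sumset-mono G k (λ _ → proj₂) x x∈B′⊕k))
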